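{- Let $n$ be a positive integer and $1\leq i\leq n$. Then \[ \mathbf{B}_{n,i}(t)=2^{n-i}\sum_{j=0}^{i-1}\binom{i-1}{j}\,\mathbf{A}_{n,i-j}(t). \]
   Context: For a permutation $\pi=\pi_1\cdots\pi_n$ of $[n]=\{1,\dots,n\}$, $\mathrm{des}(\pi)=|\{k\in[n-1]:\pi_k>\pi_{k+1}\}|$. For $1\le j\le n$, $\mathfrak{S}_{n,j}$ is the set of permutations of $[n]$ with $\pi_n=j$, and $\mathbf{A}_{n,j}(t)=\sum_{\pi\in\mathfrak{S}_{n,j}}t^{\mathrm{des}(\pi)}$. The hyperoctahedral group $\mathfrak{B}_n$ is the set of signed permutations $\pi=\pi_1\cdots\pi_n$ (words in which each of $1,\dots,n$ appears exactly once up to sign, each entry carrying a sign $\pm$). With the convention $\pi_0=0$, $\mathrm{des}_B(\pi)=|\{k\in\{0,1,\dots,n-1\}:\pi_k>\pi_{k+1}\}|$. For $j\in\{\pm1,\dots,\pm n\}$, $\mathfrak{B}_{n,j}=\{\pi\in\mathfrak{B}_n:\pi_n=j\}$ and $\mathbf{B}_{n,j}(t)=\sum_{\pi\in\mathfrak{B}_{n,j}}t^{\mathrm{des}_B(\pi)}$. -}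

module Defs where

open import Data.Nat using (ℕ; zero; suc; _+_)
open import Data.Integer as ℤ using (ℤ; +_; -_; _<?_)
import Data.Integer.Properties as ℤP
open import Data.List using (List; []; _∷_; map; concatMap; [_])
open import Data.Bool using (Bool; true; false; if_then_else_; _∧_)
open import Relation.Nullary.Decidable using (⌊_⌋)

insertAll : {A : Set} → A → List A → List (List A)
insertAll x [] = [ x ∷ [] ]
insertAll x (y ∷ ys) = (x ∷ y ∷ ys) ∷ map (y ∷_) (insertAll x ys)

-- explicit enumeration of 𝔖_n : every permutation of [n] = {1..n} exactly once,
-- as words π₁⋯πₙ (entries written as integers)
perms : ℕ → List (List ℤ)
perms zero = [] ∷ []
perms (suc n) = concatMap (insertAll (+ suc n)) (perms n)

signings : List ℤ → List (List ℤ)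
signings [] = [] ∷ []
signings (x ∷ xs) = concatMap (λ s → (x ∷ s) ∷ ((- x) ∷ s) ∷ []) (signings xs)

signedPerms : ℕ → List (List ℤ)
signedPerms n = concatMap signings (perms n)

des : List ℤ → ℕ
des [] = 0
des (x ∷ []) = 0
des (x ∷ y ∷ ys) = (if ⌊ y <? x ⌋ then 1 else 0) + des (y ∷ ys)

desB : List ℤ → ℕ
desB π = des (+ 0 ∷ π)

endsWith : ℤ → List ℤ → Bool
endsWith j [] = false
endsWith j (x ∷ []) = ⌊ x ℤP.≟ j ⌋
endsWith j (x ∷ y ∷ ys) = endsWith j (y ∷ ys)

count : {A : Set} → (A → Bool) → List A → ℕ
count p [] = 0
count p (x ∷ xs) = (if p x then 1 else 0) + count p xs

-- coefficient of t^k in A_{n,j}(t) : #{π ∈ 𝔖_n : π_n = j, des π = k}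
Acoeff : ℕ → ℤ → ℕ → ℕ
Acoeff n j k = count (λ π → endsWith j π ∧ ⌊ des π Data.Nat.≟ k ⌋) (perms n)

-- coefficient of t^k in B_{n,j}(t) : #{π ∈ 𝔅_n : π_n = j, des_B π = k}
Bcoeff : ℕ → ℤ → ℕ → ℕ
Bcoeff n j k = count (λ π → endsWith j π ∧ ⌊ desB π Data.Nat.≟ k ⌋) (signedPerms n)

{-# OPTIONS --safe #-}
module Submission where

open import Defs
open import Data.Nat using (ℕ; _≤_; _∸_; _*_; _^_)
open import Data.Nat.Combinatorics using (_C_)
open import Data.Integer using (+_)
open import Data.List using (map; upTo)
open import Data.Nat.ListAction using (sum)
open import Relation.Binary.PropositionalEquality using (_≡_)

open import Data.Bool using (Bool; true; false; if_then_else_; _∧_)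
open import Data.Bool.Properties using (∧-zeroʳ)
open import Data.Integer as ℤ using (ℤ; -_; -[1+_])
import Data.Integer.Properties as ℤ
open import Data.List using (List; []; _∷_; _++_; concatMap; length)
open import Data.List.Properties using (map-++; map-∘; map-cong; map-cong-local; map-upTo; map-applyUpTo)
open import Data.List.Relation.Unary.All as All using (All; []; _∷_)
import Data.List.Relation.Unary.All.Properties as All
open import Data.Nat using (zero; suc; _+_; _<_; _≟_; _≤′_; ≤′-refl; ≤′-step; z≤n; s≤s)
open import Data.Nat.Combinatorics using (k>n⇒nCk≡0; nCk+nC[k+1]≡[n+1]C[k+1])
open import Data.Nat.ListAction.Properties using (sum-++)
import Data.Nat.Properties as ℕ
open import Data.Nat.Tactic.RingSolver using (solve-∀)
open import Data.Product using (_×_; _,_; proj₁; proj₂)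
open import Data.Sum using (inj₁; inj₂)
open import Function using (_∘_)
open import Relation.Binary.PropositionalEquality using (_≗_; refl; sym; trans; cong; cong₂; module ≡-Reasoning)
open import Relation.Nullary using (Dec; yes; no; ¬_)
open import Relation.Nullary.Decidable using (⌊_⌋; dec-true; dec-false; isYes≗does)

-- Every permutation in 𝔖_{n+1} (signed permutation in 𝔅_{n+1}) arises exactly once by inserting n + 1
-- (resp. ±(n + 1)) into one of the n + 1 slots of a word of 𝔖_n (resp. 𝔅_n). Reading des_B on the word behind
-- a leading 0, inserting such an extreme letter inside a descent keeps des_B, inside an ascent raises it by
-- one, and at the end changes the last letter; on descent polynomials the inner slots act by the operator
-- Φ_n F = n t F + t (1 - t) F′. Hence
-- B_{n+1,i} = 2 Φ_n B_{n,i} and A_{n+1,i} = Φ_n A_{n,i} for i ≤ n, which reduces the theorem to n = i.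
-- There B_{i,i} is the descent polynomial of 𝔅_{i-1}; split by the number s of negative letters, the same
-- insertion recurrences, Pascal's rule and the identity (Φ_m + 1) A_{m+1,r} = A_{m+2,r+1} show that
-- the part with s negative letters is C(i-1,s) A_{i,i-s}.

𝟙 : Bool → ℕ
𝟙 b = if b then 1 else 0

∑ : {A : Set} → List A → (A → ℕ) → ℕ
∑ xs f = sum (map f xs)

syntax ∑ xs (λ x → e) = ∑[ x ∈ xs ] e

module _ {A : Set} where

  ∑-cong : ∀ {f g : A → ℕ} → f ≗ g → ∀ xs → ∑ xs f ≡ ∑ xs g
  ∑-cong f≗g xs = cong sum (map-cong f≗g xs)

  ∑-cong-All : ∀ {f g : A → ℕ} {xs} → All (λ x → f x ≡ g x) xs → ∑ xs f ≡ ∑ xs g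
  ∑-cong-All eqs = cong sum (map-cong-local eqs)

  ∑-++ : ∀ (f : A → ℕ) xs ys → ∑ (xs ++ ys) f ≡ ∑ xs f + ∑ ys f
  ∑-++ f xs ys = trans (cong sum (map-++ f xs ys)) (sum-++ (map f xs) (map f ys))

  ∑-+ : ∀ (f g : A → ℕ) xs → ∑[ x ∈ xs ] (f x + g x) ≡ ∑ xs f + ∑ xs g
  ∑-+ f g [] = refl
  ∑-+ f g (x ∷ xs) = begin
    f x + g x + ∑[ y ∈ xs ] (f y + g y)  ≡⟨ cong (_+_ (f x + g x)) (∑-+ f g xs) ⟩
    f x + g x + (∑ xs f + ∑ xs g)        ≡⟨ interchange (f x) (g x) (∑ xs f) (∑ xs g) ⟩
    f x + ∑ xs f + (g x + ∑ xs g)        ∎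
    where
      open ≡-Reasoning
      interchange : ∀ a b c d → a + b + (c + d) ≡ a + c + (b + d)
      interchange = solve-∀

  ∑-zero : ∀ (xs : List A) → ∑[ x ∈ xs ] 0 ≡ 0
  ∑-zero [] = refl
  ∑-zero (x ∷ xs) = ∑-zero xs

module _ {A B : Set} where

  ∑-map : ∀ (f : B → ℕ) (g : A → B) xs → ∑ (map g xs) f ≡ ∑ xs (f ∘ g)
  ∑-map f g xs = cong sum (sym (map-∘ xs))

  ∑-concatMap : ∀ (f : B → ℕ) (g : A → List B) xs → ∑ (concatMap g xs) f ≡ ∑[ x ∈ xs ] ∑ (g x) f
  ∑-concatMap f g [] = refl
  ∑-concatMap f g (x ∷ xs) = trans (∑-++ f (g x) (concatMap g xs)) (cong (_+_ (∑ (g x) f)) (∑-concatMap f g xs))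

  ∑-comm : ∀ (f : A → B → ℕ) xs ys → ∑[ x ∈ xs ] ∑[ y ∈ ys ] f x y ≡ ∑[ y ∈ ys ] ∑[ x ∈ xs ] f x y
  ∑-comm f [] ys = sym (∑-zero ys)
  ∑-comm f (x ∷ xs) ys = trans (cong (_+_ (∑ ys (f x))) (∑-comm f xs ys)) (sym (∑-+ (f x) (λ y → ∑[ x ∈ xs ] f x y) ys))

count≡∑ : ∀ {A : Set} (p : A → Bool) xs → count p xs ≡ ∑[ x ∈ xs ] 𝟙 (p x)
count≡∑ p [] = refl
count≡∑ p (x ∷ xs) = cong (_+_ (𝟙 (p x))) (count≡∑ p xs)

∑-upTo-suc : ∀ (f : ℕ → ℕ) N → ∑ (upTo (suc N)) f ≡ f 0 + ∑[ s ∈ upTo N ] f (suc s)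
∑-upTo-suc f N = cong (_+_ (f 0)) (trans (cong sum (map-applyUpTo suc f N)) (sym (cong sum (map-upTo (f ∘ suc) N))))

⌊⌋-true : ∀ {P : Set} (P? : Dec P) → P → ⌊ P? ⌋ ≡ true
⌊⌋-true P? p = trans (isYes≗does P?) (dec-true P? p)

⌊⌋-false : ∀ {P : Set} (P? : Dec P) → ¬ P → ⌊ P? ⌋ ≡ false
⌊⌋-false P? ¬p = trans (isYes≗does P?) (dec-false P? ¬p)

⌊suc≟suc⌋ : ∀ m n → ⌊ suc m ≟ suc n ⌋ ≡ ⌊ m ≟ n ⌋
⌊suc≟suc⌋ m n with m ≟ n
... | yes m≡n = ⌊⌋-true (suc m ≟ suc n) (cong suc m≡n)
... | no m≢n = ⌊⌋-false (suc m ≟ suc n) (m≢n ∘ ℕ.suc-injective)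

∑-upTo-indicator : ∀ {g N} → g < N → ∀ b → ∑[ s ∈ upTo N ] 𝟙 (⌊ g ≟ s ⌋ ∧ b) ≡ 𝟙 b
∑-upTo-indicator {zero} {suc N} _ b = begin
  ∑[ s ∈ upTo (suc N) ] 𝟙 (⌊ 0 ≟ s ⌋ ∧ b)  ≡⟨ ∑-upTo-suc (λ s → 𝟙 (⌊ 0 ≟ s ⌋ ∧ b)) N ⟩
  𝟙 b + ∑[ s ∈ upTo N ] 0                ≡⟨ cong (_+_ (𝟙 b)) (∑-zero (upTo N)) ⟩
  𝟙 b + 0                                ≡⟨ ℕ.+-identityʳ (𝟙 b) ⟩
  𝟙 b                                    ∎
  where open ≡-Reasoning
∑-upTo-indicator {suc g} {suc N} (s≤s g<N) b = begin
  ∑[ s ∈ upTo (suc N) ] 𝟙 (⌊ suc g ≟ s ⌋ ∧ b)  ≡⟨ ∑-upTo-suc (λ s → 𝟙 (⌊ suc g ≟ s ⌋ ∧ b)) N ⟩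
  ∑[ s ∈ upTo N ] 𝟙 (⌊ suc g ≟ suc s ⌋ ∧ b)
    ≡⟨ ∑-cong (λ s → cong (λ c → 𝟙 (c ∧ b)) (⌊suc≟suc⌋ g s)) (upTo N) ⟩
  ∑[ s ∈ upTo N ] 𝟙 (⌊ g ≟ s ⌋ ∧ b)            ≡⟨ ∑-upTo-indicator g<N b ⟩
  𝟙 b                                          ∎
  where open ≡-Reasoning

infixl 6 _⊕_
infixr 7 _⊛_

_⊕_ : (ℕ → ℕ) → (ℕ → ℕ) → ℕ → ℕ
(f ⊕ g) k = f k + g k

_⊛_ : ℕ → (ℕ → ℕ) → ℕ → ℕ
(c ⊛ f) k = c * f k

t· : (ℕ → ℕ) → ℕ → ℕ
t· f zero = 0
t· f (suc k) = f k

-- Agrees with n t F + t (1 - t) F′ only for deg F ≤ n, because n ∸ k truncates.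
Φ : ℕ → (ℕ → ℕ) → ℕ → ℕ
Φ n f zero = 0
Φ n f (suc k) = suc k * f (suc k) + (n ∸ k) * f k

Deg : ℕ → (ℕ → ℕ) → Set
Deg n f = ∀ k → n < k → f k ≡ 0

Deg-suc : ∀ {n f} → Deg n f → Deg (suc n) f
Deg-suc deg k n<k = deg k (ℕ.<-trans (ℕ.n<1+n _) n<k)

*-𝟙-≟ : ∀ (g : ℕ → ℕ) b d k → g d * 𝟙 (b ∧ ⌊ d ≟ k ⌋) ≡ g k * 𝟙 (b ∧ ⌊ d ≟ k ⌋)
*-𝟙-≟ g false d k = trans (ℕ.*-zeroʳ (g d)) (sym (ℕ.*-zeroʳ (g k)))
*-𝟙-≟ g true d k with d ≟ k
... | yes refl = refl
... | no _ = trans (ℕ.*-zeroʳ (g d)) (sym (ℕ.*-zeroʳ (g k)))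

monomial : Bool → ℕ → ℕ → ℕ
monomial b d k = 𝟙 (b ∧ ⌊ d ≟ k ⌋)

module _ {n : ℕ} where

  Φ-cong : ∀ {f g} → f ≗ g → Φ n f ≗ Φ n g
  Φ-cong f≗g zero = refl
  Φ-cong f≗g (suc k) = cong₂ (λ a b → suc k * a + (n ∸ k) * b) (f≗g (suc k)) (f≗g k)

  Φ-⊕ : ∀ f g → Φ n (f ⊕ g) ≗ Φ n f ⊕ Φ n g
  Φ-⊕ f g zero = refl
  Φ-⊕ f g (suc k) = distrib (suc k) (n ∸ k) (f (suc k)) (g (suc k)) (f k) (g k)
    where
      distrib : ∀ a b c d e h → a * (c + d) + b * (e + h) ≡ a * c + b * e + (a * d + b * h)
      distrib = solve-∀

  Φ-⊛ : ∀ c f → Φ n (c ⊛ f) ≗ c ⊛ Φ n f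
  Φ-⊛ c f zero = sym (ℕ.*-zeroʳ c)
  Φ-⊛ c f (suc k) = pull (suc k) (n ∸ k) c (f (suc k)) (f k)
    where
      pull : ∀ a b c d e → a * (c * d) + b * (c * e) ≡ c * (a * d + b * e)
      pull = solve-∀

  Φ-zero : ∀ {f} → f ≗ (λ _ → 0) → Φ n f ≗ (λ _ → 0)
  Φ-zero f≗0 zero = refl
  Φ-zero f≗0 (suc k) rewrite f≗0 k | f≗0 (suc k) = cong₂ _+_ (ℕ.*-zeroʳ (suc k)) (ℕ.*-zeroʳ (n ∸ k))

  Φ-∑ : ∀ {A : Set} (f : A → ℕ → ℕ) xs → Φ n (λ k → ∑[ x ∈ xs ] f x k) ≗ λ k → ∑[ x ∈ xs ] Φ n (f x) k
  Φ-∑ f [] = Φ-zero (λ _ → refl)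
  Φ-∑ f (x ∷ xs) k = trans (Φ-⊕ (f x) (λ k → ∑[ y ∈ xs ] f y k) k) (cong (_+_ (Φ n (f x) k)) (Φ-∑ f xs k))

  ∑-Φ-⊕ : ∀ {A : Set} (f g : A → ℕ → ℕ) xs →
    (λ k → ∑[ x ∈ xs ] (Φ n (f x) ⊕ g x) k) ≗ Φ n (λ k → ∑[ x ∈ xs ] f x k) ⊕ (λ k → ∑[ x ∈ xs ] g x k)
  ∑-Φ-⊕ f g xs k = trans (∑-+ (λ x → Φ n (f x) k) (λ x → g x k) xs) (cong (_+ ∑[ x ∈ xs ] g x k) (sym (Φ-∑ f xs k)))

  Φ-monomial : ∀ b d k → Φ n (monomial b d) k ≡ d * monomial b d k + (n ∸ d) * monomial b (suc d) k
  Φ-monomial b d zero = sym (cong₂ _+_ (*-𝟙-≟ (λ x → x) b d 0)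
    (trans (cong (λ c → (n ∸ d) * 𝟙 c) (∧-zeroʳ b)) (ℕ.*-zeroʳ (n ∸ d))))
  Φ-monomial b d (suc k) = sym (cong₂ _+_ (*-𝟙-≟ (λ x → x) b d (suc k))
    (trans (cong (λ c → (n ∸ d) * 𝟙 (b ∧ c)) (⌊suc≟suc⌋ d k)) (*-𝟙-≟ (n ∸_) b d k)))

t·-cong : ∀ {f g} → f ≗ g → t· f ≗ t· g
t·-cong f≗g zero = refl
t·-cong f≗g (suc k) = f≗g k

t·-zero : ∀ {f} → f ≗ (λ _ → 0) → t· f ≗ (λ _ → 0)
t·-zero f≗0 zero = refl
t·-zero f≗0 (suc k) = f≗0 k

t·-⊛ : ∀ c f → t· (c ⊛ f) ≗ c ⊛ t· f
t·-⊛ c f zero = sym (ℕ.*-zeroʳ c)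
t·-⊛ c f (suc k) = refl

t·-∑ : ∀ {A : Set} (f : A → ℕ → ℕ) xs → t· (λ k → ∑[ x ∈ xs ] f x k) ≗ λ k → ∑[ x ∈ xs ] t· (f x) k
t·-∑ f xs zero = sym (∑-zero xs)
t·-∑ f xs (suc k) = refl

t·-monomial : ∀ b d → t· (monomial b d) ≗ monomial b (suc d)
t·-monomial b d zero = cong 𝟙 (sym (∧-zeroʳ b))
t·-monomial b d (suc k) = cong (λ c → 𝟙 (b ∧ c)) (sym (⌊suc≟suc⌋ d k))

Φ-suc : ∀ {n f} → Deg n f → Φ (suc n) f ≗ Φ n f ⊕ t· f
Φ-suc deg zero = refl
Φ-suc {n} {f} deg (suc k) with ℕ.≤-<-connex k n
... | inj₁ k≤n rewrite ℕ.+-∸-assoc 1 k≤n = expand (suc k * f (suc k)) (n ∸ k) (f k)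
  where
    expand : ∀ a m c → a + (1 + m) * c ≡ a + m * c + c
    expand = solve-∀
... | inj₂ n<k rewrite deg k n<k | ℕ.*-zeroʳ (suc n ∸ k) | ℕ.*-zeroʳ (n ∸ k) = sym (ℕ.+-identityʳ _)

Φ-t· : ∀ {n} f → Φ (suc n) (t· f) ≗ t· (Φ n f) ⊕ t· f
Φ-t· f zero = refl
Φ-t· {n} f (suc zero) = trans (cong (_+_ (1 * f 0)) (ℕ.*-zeroʳ (suc n))) (trans (ℕ.+-identityʳ _) (ℕ.*-identityˡ _))
Φ-t· {n} f (suc (suc k)) = expand (f (suc k)) (f k) k (n ∸ k)
  where
    expand : ∀ a b k m → suc (suc k) * a + m * b ≡ suc k * a + m * b + a
    expand = solve-∀

Φ-deg : ∀ {n f} → Deg n f → Deg (suc n) (Φ n f)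
Φ-deg {n} {f} deg (suc k) (s≤s n<k)
  rewrite deg k n<k | deg (suc k) (ℕ.<-trans n<k (ℕ.n<1+n k)) | ℕ.*-zeroʳ k | ℕ.*-zeroʳ (n ∸ k) = refl

Φ-square : ∀ {n H} → Deg n H → Φ (suc n) (Φ (suc n) H) ⊕ Φ (suc n) H ≗ Φ (suc (suc n)) (Φ n H ⊕ H)
Φ-square {n} {H} deg k = begin
  Φ (suc n) (Φ (suc n) H) k + Φ (suc n) H k
    ≡⟨ cong (_+ Φ (suc n) H k) (trans (Φ-cong (Φ-suc deg) k) (Φ-⊕ (Φ n H) (t· H) k)) ⟩
  Φ (suc n) (Φ n H) k + Φ (suc n) (t· H) k + Φ (suc n) H k
    ≡⟨ cong (λ x → Φ (suc n) (Φ n H) k + x + Φ (suc n) H k) (Φ-t· H k) ⟩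
  Φ (suc n) (Φ n H) k + (t· (Φ n H) k + t· H k) + Φ (suc n) H k
    ≡⟨ regroup (Φ (suc n) (Φ n H) k) (t· (Φ n H) k) (t· H k) (Φ (suc n) H k) ⟩
  Φ (suc n) (Φ n H) k + t· (Φ n H) k + (Φ (suc n) H k + t· H k)
    ≡⟨ sym (cong₂ _+_ (Φ-suc (Φ-deg deg) k) (Φ-suc (Deg-suc deg) k)) ⟩
  Φ (suc (suc n)) (Φ n H) k + Φ (suc (suc n)) H k
    ≡⟨ sym (Φ-⊕ (Φ n H) H k) ⟩
  Φ (suc (suc n)) (Φ n H ⊕ H) k ∎
  where
    open ≡-Reasoning
    regroup : ∀ a b c d → a + (b + c) + d ≡ a + b + (d + c)
    regroup = solve-∀

-- c is the number of descents created when x directly follows u.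
data Side (x : ℤ) : ℕ → ℤ → Set where
  above : ∀ {u} → u ℤ.< x → Side x 0 u
  below : ∀ {u} → x ℤ.< u → Side x 1 u

Side-after : ∀ {x c u} → Side x c u → 𝟙 ⌊ x ℤ.<? u ⌋ ≡ c
Side-after {x} {u = u} (above u<x) = cong 𝟙 (⌊⌋-false (x ℤ.<? u) (ℤ.<-asym u<x))
Side-after {x} {u = u} (below x<u) = cong 𝟙 (⌊⌋-true (x ℤ.<? u) x<u)

Side-before : ∀ {x c u} → Side x c u → 𝟙 ⌊ u ℤ.<? x ⌋ + c ≡ 1
Side-before {x} {u = u} (above u<x) = cong (λ b → 𝟙 b + 0) (⌊⌋-true (u ℤ.<? x) u<x)
Side-before {x} {u = u} (below x<u) = cong (λ b → 𝟙 b + 1) (⌊⌋-false (u ℤ.<? x) (ℤ.<-asym x<u))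

𝟙≤1 : ∀ b → 𝟙 b ≤ 1
𝟙≤1 true = s≤s z≤n
𝟙≤1 false = z≤n

des-≤ : ∀ y ys → des (y ∷ ys) ≤ length ys
des-≤ y [] = z≤n
des-≤ y (y′ ∷ ys) = ℕ.+-mono-≤ (𝟙≤1 _) (des-≤ y′ ys)

insertAll-∷-endsWith : ∀ j x y ws → All (λ τ → endsWith j (y ∷ τ) ≡ endsWith j τ) (insertAll x ws)
insertAll-∷-endsWith j x y [] = refl ∷ []
insertAll-∷-endsWith j x y (w ∷ ws) = refl ∷ All.map⁺ (All.universal (λ _ → refl) (insertAll x ws))

-- Only the empty tail has a different last letter, and then both weights vanish.
inner-slots-endsWith : ∀ j y ys (a b : Bool → ℕ) →
  des (y ∷ ys) * a (endsWith j ys) + (length ys ∸ des (y ∷ ys)) * b (endsWith j ys)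
  ≡ des (y ∷ ys) * a (endsWith j (y ∷ ys)) + (length ys ∸ des (y ∷ ys)) * b (endsWith j (y ∷ ys))
inner-slots-endsWith j y [] a b = refl
inner-slots-endsWith j y (_ ∷ _) a b = refl

first-slot : ∀ β (a : ℕ → ℕ) D L → D ≤ L →
  a (suc D) + (D * a (𝟙 β + D) + (L ∸ D) * a (𝟙 β + suc D))
  ≡ (𝟙 β + D) * a (𝟙 β + D) + (suc L ∸ (𝟙 β + D)) * a (suc (𝟙 β + D))
first-slot true a D L _ = sym (ℕ.+-assoc (a (suc D)) (D * a (suc D)) _)
first-slot false a D L D≤L rewrite ℕ.+-∸-assoc 1 D≤L = absorb (a (suc D)) (D * a D) (L ∸ D)
  where
    absorb : ∀ a b m → a + (b + m * a) ≡ b + (1 + m) * a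
    absorb = solve-∀

-- Of the slots after z, those inside a descent keep des, those inside an ascent raise it by one,
-- and the end slot raises it by c.
∑-insertAll : ∀ j x c (F : Bool → ℕ → ℕ) z w → All (Side x c) (z ∷ w) →
  ∑[ τ ∈ insertAll x w ] F (endsWith j τ) (des (z ∷ τ))
  ≡ des (z ∷ w) * F (endsWith j w) (des (z ∷ w)) + (length w ∸ des (z ∷ w)) * F (endsWith j w) (suc (des (z ∷ w)))
    + F ⌊ x ℤ.≟ j ⌋ (c + des (z ∷ w))
∑-insertAll j x c F z [] (sz ∷ []) = trans (ℕ.+-identityʳ _) (cong (λ d → F ⌊ x ℤ.≟ j ⌋ (d + 0)) (Side-after sz))
∑-insertAll j x c F z (y ∷ ys) (sz ∷ sy ∷ rest) = begin
    F e (𝟙 ⌊ x ℤ.<? z ⌋ + (𝟙 ⌊ y ℤ.<? x ⌋ + D)) + ∑[ τ ∈ map (y ∷_) (insertAll x ys) ] F (endsWith j τ) (des (z ∷ τ))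
  ≡⟨ cong₂ _+_ (cong (F e) x-between-z-y) (∑-map (λ τ → F (endsWith j τ) (des (z ∷ τ))) (y ∷_) (insertAll x ys)) ⟩
    F e (suc D) + ∑[ τ ∈ insertAll x ys ] F (endsWith j (y ∷ τ)) (des (z ∷ y ∷ τ))
  ≡⟨ cong (_+_ (F e (suc D))) (∑-cong-All (All.map (cong (λ b → F b _)) (insertAll-∷-endsWith j x y ys))) ⟩
    F e (suc D) + ∑[ τ ∈ insertAll x ys ] F′ (endsWith j τ) (des (y ∷ τ))
  ≡⟨ cong (_+_ (F e (suc D))) (∑-insertAll j x c F′ y ys (sy ∷ rest)) ⟩
    F e (suc D) + (D * F′ (endsWith j ys) D + (length ys ∸ D) * F′ (endsWith j ys) (suc D) + F′ xj (c + D))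
  ≡⟨ cong (λ s → F e (suc D) + (s + F′ xj (c + D))) (inner-slots-endsWith j y ys (λ b → F′ b D) (λ b → F′ b (suc D))) ⟩
    F e (suc D) + (D * F′ e D + (length ys ∸ D) * F′ e (suc D) + F′ xj (c + D))
  ≡⟨ sym (ℕ.+-assoc (F e (suc D)) _ _) ⟩
    F e (suc D) + (D * F′ e D + (length ys ∸ D) * F′ e (suc D)) + F xj (𝟙 β + (c + D))
  ≡⟨ cong₂ _+_ (first-slot β (F e) D (length ys) (des-≤ y ys)) (cong (F xj) (left-comm (𝟙 β) c D)) ⟩
    (𝟙 β + D) * F e (𝟙 β + D) + (suc (length ys) ∸ (𝟙 β + D)) * F e (suc (𝟙 β + D)) + F xj (c + (𝟙 β + D)) ∎
  where
    open ≡-Reasoning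
    e = endsWith j (y ∷ ys)
    D = des (y ∷ ys)
    β = ⌊ y ℤ.<? z ⌋
    xj = ⌊ x ℤ.≟ j ⌋
    left-comm : ∀ a b d → a + (b + d) ≡ b + (a + d)
    left-comm = solve-∀
    F′ : Bool → ℕ → ℕ
    F′ b d = F b (𝟙 β + d)
    x-between-z-y : 𝟙 ⌊ x ℤ.<? z ⌋ + (𝟙 ⌊ y ℤ.<? x ⌋ + D) ≡ suc D
    x-between-z-y = begin
      𝟙 ⌊ x ℤ.<? z ⌋ + (𝟙 ⌊ y ℤ.<? x ⌋ + D)  ≡⟨ cong (_+ (𝟙 ⌊ y ℤ.<? x ⌋ + D)) (Side-after sz) ⟩
      c + (𝟙 ⌊ y ℤ.<? x ⌋ + D)              ≡⟨ sym (ℕ.+-assoc c _ D) ⟩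
      c + 𝟙 ⌊ y ℤ.<? x ⌋ + D                ≡⟨ cong (_+ D) (trans (ℕ.+-comm c _) (Side-before sy)) ⟩
      suc D                                 ∎

All-concatMap : ∀ {A B : Set} {P : B → Set} (g : A → List B) {xs} → All (All P ∘ g) xs → All P (concatMap g xs)
All-concatMap g = All.concat⁺ ∘ All.map⁺

insertAll-All : ∀ {Q : ℤ → Set} {x} w → Q x → All Q w → All (All Q) (insertAll x w)
insertAll-All [] qx [] = (qx ∷ []) ∷ []
insertAll-All (y ∷ ys) qx (qy ∷ qys) = (qx ∷ qy ∷ qys) ∷ All.map⁺ (All.map (qy ∷_) (insertAll-All ys qx qys))

insertAll-length : ∀ x (w : List ℤ) → All (λ τ → length τ ≡ suc (length w)) (insertAll x w)
insertAll-length x [] = refl ∷ []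
insertAll-length x (y ∷ ys) = refl ∷ All.map⁺ (All.map (cong suc) (insertAll-length x ys))

signings-All : ∀ {Q : ℤ → Set} → (∀ u → Q u → Q (- u)) → ∀ w → All Q w → All (All Q) (signings w)
signings-All Q-neg [] [] = [] ∷ []
signings-All Q-neg (y ∷ ys) (qy ∷ qys) =
  All-concatMap _ (All.map (λ qs → (qy ∷ qs) ∷ (Q-neg y qy ∷ qs) ∷ []) (signings-All Q-neg ys qys))

signings-length : ∀ w → All (λ σ → length σ ≡ length w) (signings w)
signings-length [] = refl ∷ []
signings-length (y ∷ ys) = All-concatMap _ (All.map (λ l → cong suc l ∷ cong suc l ∷ []) (signings-length ys))

Bounded : ℕ → List ℤ → Set
Bounded n w = length w ≡ n × All (λ u → ℤ.∣ u ∣ ≤ n) w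

perms-length : ∀ n → All (λ π → length π ≡ n) (perms n)
perms-length zero = refl ∷ []
perms-length (suc n) = All-concatMap (insertAll (+ suc n)) (All.map grow (perms-length n))
  where
    grow : ∀ {π} → length π ≡ n → All (λ τ → length τ ≡ suc n) (insertAll (+ suc n) π)
    grow {π} l = All.map (λ l′ → trans l′ (cong suc l)) (insertAll-length (+ suc n) π)

PosLetter : ℕ → ℤ → Set
PosLetter n u = + 0 ℤ.< u × ℤ.∣ u ∣ ≤ n

perms-letters : ∀ n → All (All (PosLetter n)) (perms n)
perms-letters zero = [] ∷ []
perms-letters (suc n) = All-concatMap _ (All.map (λ {π} a → insertAll-All π new (All.map widen a)) (perms-letters n))
  where
    new : PosLetter (suc n) (+ suc n)
    new = ℤ.+<+ (s≤s z≤n) , ℕ.≤-refl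
    widen : ∀ {u} → PosLetter n u → PosLetter (suc n) u
    widen (0<u , ∣u∣≤n) = 0<u , ℕ.m≤n⇒m≤1+n ∣u∣≤n

perms-bounded : ∀ n → All (Bounded n) (perms n)
perms-bounded n = All.zipWith (λ (l , a) → l , All.map proj₂ a) (perms-length n , perms-letters n)

signedPerms-bounded : ∀ n → All (Bounded n) (signedPerms n)
signedPerms-bounded n = All-concatMap signings (All.map signings-bounded (perms-bounded n))
  where
    abs-neg : ∀ u → ℤ.∣ u ∣ ≤ n → ℤ.∣ - u ∣ ≤ n
    abs-neg u b = ℕ.≤-trans (ℕ.≤-reflexive (ℤ.∣-i∣≡∣i∣ u)) b
    signings-bounded : ∀ {π} → Bounded n π → All (Bounded n) (signings π)
    signings-bounded {π} (l , a) =
      All.zipWith (λ (l′ , a′) → trans l′ l , a′) (signings-length π , signings-All {Q = λ u → ℤ.∣ u ∣ ≤ n} abs-neg π a)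

max-Side : ∀ {n} w → All (λ u → ℤ.∣ u ∣ ≤ n) w → All (Side (+ suc n) 0) (+ 0 ∷ w)
max-Side w a = above (ℤ.+<+ (s≤s z≤n)) ∷ All.map (above ∘ below-suc) a
  where
    below-suc : ∀ {n u} → ℤ.∣ u ∣ ≤ n → u ℤ.< + suc n
    below-suc {u = + m} b = ℤ.+<+ (s≤s b)
    below-suc {u = -[1+ m ]} b = ℤ.-<+

min-Side : ∀ {n} w → All (λ u → ℤ.∣ u ∣ ≤ n) w → All (Side -[1+ n ] 1) (+ 0 ∷ w)
min-Side w a = below ℤ.-<+ ∷ All.map (below ∘ above-neg) a
  where
    above-neg : ∀ {n u} → ℤ.∣ u ∣ ≤ n → -[1+ n ] ℤ.< u
    above-neg {u = + m} b = ℤ.-<+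
    above-neg {u = -[1+ m ]} b = ℤ.-<- b

endsWith-max : ∀ {n} w → All (λ u → ℤ.∣ u ∣ ≤ n) w → endsWith (+ suc n) w ≡ false
endsWith-max [] _ = refl
endsWith-max {n} (u ∷ []) (b ∷ []) = ⌊⌋-false (u ℤ.≟ + suc n) (λ { refl → ℕ.<-irrefl refl (s≤s b) })
endsWith-max (u ∷ v ∷ vs) (_ ∷ a) = endsWith-max (v ∷ vs) a

insertMax : ∀ {n σ} → Bounded n σ → ∀ j (b : Bool → Bool) →
  (λ k → ∑[ τ ∈ insertAll (+ suc n) σ ] monomial (b (endsWith j τ)) (desB τ) k)
  ≗ Φ n (monomial (b (endsWith j σ)) (desB σ)) ⊕ monomial (b ⌊ + suc n ℤ.≟ j ⌋) (desB σ)
insertMax {σ = σ} (refl , a) j b k =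
  trans (∑-insertAll j _ 0 (λ e d → monomial (b e) d k) (+ 0) σ (max-Side σ a))
        (cong (_+ monomial (b ⌊ + suc (length σ) ℤ.≟ j ⌋) (desB σ) k) (sym (Φ-monomial (b (endsWith j σ)) (desB σ) k)))

insertMin : ∀ {n σ} → Bounded n σ → ∀ j (b : Bool → Bool) →
  (λ k → ∑[ τ ∈ insertAll -[1+ n ] σ ] monomial (b (endsWith j τ)) (desB τ) k)
  ≗ Φ n (monomial (b (endsWith j σ)) (desB σ)) ⊕ t· (monomial (b ⌊ -[1+ n ] ℤ.≟ j ⌋) (desB σ))
insertMin {σ = σ} (refl , a) j b k =
  trans (∑-insertAll j _ 1 (λ e d → monomial (b e) d k) (+ 0) σ (min-Side σ a))
        (cong₂ _+_ (sym (Φ-monomial (b (endsWith j σ)) (desB σ) k)) (sym (t·-monomial _ (desB σ) k)))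

neg : List ℤ → ℕ
neg = count (λ u → ⌊ u ℤ.<? + 0 ⌋)

neg-≤ : ∀ w → neg w ≤ length w
neg-≤ [] = z≤n
neg-≤ (u ∷ w) = ℕ.+-mono-≤ (𝟙≤1 ⌊ u ℤ.<? + 0 ⌋) (neg-≤ w)

insertAll-neg : ∀ x w → All (λ τ → neg τ ≡ 𝟙 ⌊ x ℤ.<? + 0 ⌋ + neg w) (insertAll x w)
insertAll-neg x [] = refl ∷ []
insertAll-neg x (y ∷ ys) = refl ∷ All.map⁺ (All.map (λ {τ} → behind-y {τ}) (insertAll-neg x ys))
  where
    [y<0] [x<0] : ℕ
    [y<0] = 𝟙 ⌊ y ℤ.<? + 0 ⌋
    [x<0] = 𝟙 ⌊ x ℤ.<? + 0 ⌋
    left-comm : ∀ a b c → a + (b + c) ≡ b + (a + c)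
    left-comm = solve-∀
    behind-y : ∀ {τ} → neg τ ≡ [x<0] + neg ys → [y<0] + neg τ ≡ [x<0] + ([y<0] + neg ys)
    behind-y eq = trans (cong (_+_ [y<0]) eq) (left-comm [y<0] [x<0] (neg ys))

∑-signings-∷ : ∀ (f : List ℤ → ℕ) y ys → ∑ (signings (y ∷ ys)) f ≡ ∑[ s ∈ signings ys ] (f (y ∷ s) + f (- y ∷ s))
∑-signings-∷ f y ys = trans (∑-concatMap f (λ s → (y ∷ s) ∷ (- y ∷ s) ∷ []) (signings ys))
                             (∑-cong (λ s → cong (_+_ (f (y ∷ s))) (ℕ.+-identityʳ (f (- y ∷ s)))) (signings ys))

sumInsert± : ℤ → List ℤ → (List ℤ → ℕ) → ℕ
sumInsert± x σ f = ∑ (insertAll x σ) f + ∑ (insertAll (- x) σ) f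

∑-signings-insertAll : ∀ x w (f : List ℤ → ℕ) →
  ∑ (concatMap signings (insertAll x w)) f ≡ ∑[ σ ∈ signings w ] sumInsert± x σ f
∑-signings-insertAll x [] f = regroup (f (x ∷ [])) (f (- x ∷ []))
  where
    regroup : ∀ a b → a + (b + 0) ≡ a + 0 + (b + 0) + 0
    regroup = solve-∀
∑-signings-insertAll x (y ∷ ys) f = begin
    ∑ (signings (x ∷ y ∷ ys) ++ concatMap signings (map (y ∷_) (insertAll x ys))) f
  ≡⟨ ∑-++ f (signings (x ∷ y ∷ ys)) _ ⟩
    ∑ (signings (x ∷ y ∷ ys)) f + ∑ (concatMap signings (map (y ∷_) (insertAll x ys))) f
  ≡⟨ cong₂ _+_ (trans (∑-signings-∷ f x (y ∷ ys)) (∑-signings-∷ (λ s → f (x ∷ s) + f (- x ∷ s)) y ys)) later-slots ⟩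
    ∑ (signings ys) front + ∑[ σ ∈ signings ys ] sumInsert± x σ g
  ≡⟨ sym (∑-+ front (λ σ → sumInsert± x σ g) (signings ys)) ⟩
    ∑[ σ ∈ signings ys ] (front σ + sumInsert± x σ g)
  ≡⟨ ∑-cong split-sign (signings ys) ⟩
    ∑[ σ ∈ signings ys ] (sumInsert± x (y ∷ σ) f + sumInsert± x (- y ∷ σ) f)
  ≡⟨ sym (∑-signings-∷ (λ σ → sumInsert± x σ f) y ys) ⟩
    ∑[ σ ∈ signings (y ∷ ys) ] sumInsert± x σ f ∎
  where
    open ≡-Reasoning
    g : List ℤ → ℕ
    g s = f (y ∷ s) + f (- y ∷ s)
    front : List ℤ → ℕ
    front s = f (x ∷ y ∷ s) + f (- x ∷ y ∷ s) + (f (x ∷ - y ∷ s) + f (- x ∷ - y ∷ s))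
    later-slots : ∑ (concatMap signings (map (y ∷_) (insertAll x ys))) f ≡ ∑[ σ ∈ signings ys ] sumInsert± x σ g
    later-slots = begin
        ∑ (concatMap signings (map (y ∷_) (insertAll x ys))) f
      ≡⟨ ∑-concatMap f signings (map (y ∷_) (insertAll x ys)) ⟩
        ∑[ τ ∈ map (y ∷_) (insertAll x ys) ] ∑ (signings τ) f
      ≡⟨ ∑-map (λ τ → ∑ (signings τ) f) (y ∷_) (insertAll x ys) ⟩
        ∑[ τ ∈ insertAll x ys ] ∑ (signings (y ∷ τ)) f
      ≡⟨ ∑-cong (∑-signings-∷ f y) (insertAll x ys) ⟩
        ∑[ τ ∈ insertAll x ys ] ∑ (signings τ) g
      ≡⟨ sym (∑-concatMap g signings (insertAll x ys)) ⟩
        ∑ (concatMap signings (insertAll x ys)) g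
      ≡⟨ ∑-signings-insertAll x ys g ⟩
        ∑[ σ ∈ signings ys ] sumInsert± x σ g ∎
    split-sign : ∀ σ → front σ + sumInsert± x σ g ≡ sumInsert± x (y ∷ σ) f + sumInsert± x (- y ∷ σ) f
    split-sign σ
      rewrite ∑-+ (λ s → f (y ∷ s)) (λ s → f (- y ∷ s)) (insertAll x σ)
            | ∑-+ (λ s → f (y ∷ s)) (λ s → f (- y ∷ s)) (insertAll (- x) σ)
            | ∑-map f (y ∷_) (insertAll x σ) | ∑-map f (- y ∷_) (insertAll x σ)
            | ∑-map f (y ∷_) (insertAll (- x) σ) | ∑-map f (- y ∷_) (insertAll (- x) σ) =
      regroup (f (x ∷ y ∷ σ)) (f (- x ∷ y ∷ σ)) (f (x ∷ - y ∷ σ)) (f (- x ∷ - y ∷ σ))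
              (∑[ s ∈ insertAll x σ ] f (y ∷ s)) (∑[ s ∈ insertAll x σ ] f (- y ∷ s))
              (∑[ s ∈ insertAll (- x) σ ] f (y ∷ s)) (∑[ s ∈ insertAll (- x) σ ] f (- y ∷ s))
      where
        regroup : ∀ a₁ a₂ a₃ a₄ b₁ b₂ b₃ b₄ →
          a₁ + a₂ + (a₃ + a₄) + (b₁ + b₂ + (b₃ + b₄)) ≡ a₁ + b₁ + (a₂ + b₃) + (a₃ + b₂ + (a₄ + b₄))
        regroup = solve-∀

∑-perms-suc : ∀ n (f : List ℤ → ℕ) → ∑ (perms (suc n)) f ≡ ∑[ π ∈ perms n ] ∑ (insertAll (+ suc n) π) f
∑-perms-suc n f = ∑-concatMap f (insertAll (+ suc n)) (perms n)

∑-signedPerms-suc : ∀ n (f : List ℤ → ℕ) → ∑ (signedPerms (suc n)) f ≡ ∑[ σ ∈ signedPerms n ] sumInsert± (+ suc n) σ f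
∑-signedPerms-suc n f = begin
    ∑ (concatMap signings (concatMap (insertAll x) (perms n))) f
  ≡⟨ ∑-concatMap f signings (concatMap (insertAll x) (perms n)) ⟩
    ∑[ τ ∈ concatMap (insertAll x) (perms n) ] ∑ (signings τ) f
  ≡⟨ ∑-concatMap (λ τ → ∑ (signings τ) f) (insertAll x) (perms n) ⟩
    ∑[ π ∈ perms n ] ∑[ τ ∈ insertAll x π ] ∑ (signings τ) f
  ≡⟨ ∑-cong (λ π → trans (sym (∑-concatMap f signings (insertAll x π))) (∑-signings-insertAll x π f)) (perms n) ⟩
    ∑[ π ∈ perms n ] ∑[ σ ∈ signings π ] sumInsert± x σ f
  ≡⟨ sym (∑-concatMap (λ σ → sumInsert± x σ f) signings (perms n)) ⟩
    ∑[ σ ∈ signedPerms n ] sumInsert± x σ f ∎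
  where
    open ≡-Reasoning
    x = + suc n

-- desPoly p ws k is the coefficient of t^k in ∑ {w ∈ ws, p w} t^(des_B w). On unsigned permutations
-- des_B = des (desB-positive), so A n j is the paper's A_{n,j}.
desPoly : (List ℤ → Bool) → List (List ℤ) → ℕ → ℕ
desPoly p ws k = ∑[ w ∈ ws ] monomial (p w) (desB w) k

A : ℕ → ℕ → ℕ → ℕ
A n j = desPoly (endsWith (+ j)) (perms n)

Atotal : ℕ → ℕ → ℕ
Atotal n = desPoly (λ _ → true) (perms n)

B : ℕ → ℕ → ℕ → ℕ
B n j = desPoly (endsWith (+ j)) (signedPerms n)

Btotal : ℕ → ℕ → ℕ
Btotal n = desPoly (λ _ → true) (signedPerms n)

Bneg : ℕ → ℕ → ℕ → ℕ
Bneg n s = desPoly (λ σ → ⌊ neg σ ≟ s ⌋) (signedPerms n)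

desPoly-cong-All : ∀ {p q ws} → All (λ w → p w ≡ q w) ws → desPoly p ws ≗ desPoly q ws
desPoly-cong-All eqs k = ∑-cong-All (All.map (λ {w} eq → cong (λ b → monomial b (desB w) k) eq) eqs)

desPoly-cong : ∀ {p q} → p ≗ q → ∀ ws → desPoly p ws ≗ desPoly q ws
desPoly-cong p≗q ws = desPoly-cong-All (All.universal p≗q ws)

desPoly-false : ∀ {b} ws → b ≡ false → desPoly (λ _ → b) ws ≗ λ _ → 0
desPoly-false ws refl k = ∑-zero ws

desPoly-endsWith-max : ∀ {n ws} → All (Bounded n) ws → desPoly (endsWith (+ suc n)) ws ≗ λ _ → 0
desPoly-endsWith-max {n} {ws} bds k =
  trans (desPoly-cong-All (All.map (λ {w} (_ , a) → endsWith-max w a) bds) k) (desPoly-false ws refl k)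

desPoly-perms-suc : ∀ n j (b : Bool → Bool) →
  desPoly (b ∘ endsWith j) (perms (suc n))
  ≗ Φ n (desPoly (b ∘ endsWith j) (perms n)) ⊕ desPoly (λ _ → b ⌊ + suc n ℤ.≟ j ⌋) (perms n)
desPoly-perms-suc n j b k =
  trans (∑-perms-suc n (λ τ → monomial (b (endsWith j τ)) (desB τ) k))
        (trans (∑-cong-All (All.map (λ bd → insertMax bd j b k) (perms-bounded n)))
               (∑-Φ-⊕ (λ π → monomial (b (endsWith j π)) (desB π))
                      (λ π → monomial (b ⌊ + suc n ℤ.≟ j ⌋) (desB π)) (perms n) k))

desPoly-signedPerms-suc : ∀ n j (b : Bool → ℕ → Bool) →
  desPoly (λ σ → b (endsWith j σ) (neg σ)) (signedPerms (suc n))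
  ≗ Φ n (desPoly (λ σ → b (endsWith j σ) (neg σ)) (signedPerms n))
      ⊕ desPoly (λ σ → b ⌊ + suc n ℤ.≟ j ⌋ (neg σ)) (signedPerms n)
    ⊕ (Φ n (desPoly (λ σ → b (endsWith j σ) (suc (neg σ))) (signedPerms n))
      ⊕ t· (desPoly (λ σ → b ⌊ -[1+ n ] ℤ.≟ j ⌋ (suc (neg σ))) (signedPerms n)))
desPoly-signedPerms-suc n j b k = begin
    ∑[ τ ∈ signedPerms (suc n) ] f τ
  ≡⟨ ∑-signedPerms-suc n f ⟩
    ∑[ σ ∈ signedPerms n ] sumInsert± (+ suc n) σ f
  ≡⟨ ∑-cong-All (All.map (λ {σ} bd → cong₂ _+_ (max-slots bd) (min-slots bd)) (signedPerms-bounded n)) ⟩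
    ∑[ σ ∈ signedPerms n ] ((Φ n (M⁺ σ) ⊕ E⁺ σ) k + (Φ n (M⁻ σ) ⊕ t· (E⁻ σ)) k)
  ≡⟨ ∑-+ (λ σ → (Φ n (M⁺ σ) ⊕ E⁺ σ) k) (λ σ → (Φ n (M⁻ σ) ⊕ t· (E⁻ σ)) k) (signedPerms n) ⟩
    ∑[ σ ∈ signedPerms n ] (Φ n (M⁺ σ) ⊕ E⁺ σ) k + ∑[ σ ∈ signedPerms n ] (Φ n (M⁻ σ) ⊕ t· (E⁻ σ)) k
  ≡⟨ cong₂ _+_ (∑-Φ-⊕ M⁺ E⁺ (signedPerms n) k)
               (trans (∑-Φ-⊕ M⁻ (t· ∘ E⁻) (signedPerms n) k) (cong (_+_ _) (sym (t·-∑ E⁻ (signedPerms n) k)))) ⟩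
    _ ∎
  where
    open ≡-Reasoning
    f : List ℤ → ℕ
    f τ = monomial (b (endsWith j τ) (neg τ)) (desB τ) k
    M⁺ M⁻ E⁺ E⁻ : List ℤ → ℕ → ℕ
    M⁺ σ = monomial (b (endsWith j σ) (neg σ)) (desB σ)
    M⁻ σ = monomial (b (endsWith j σ) (suc (neg σ))) (desB σ)
    E⁺ σ = monomial (b ⌊ + suc n ℤ.≟ j ⌋ (neg σ)) (desB σ)
    E⁻ σ = monomial (b ⌊ -[1+ n ] ℤ.≟ j ⌋ (suc (neg σ))) (desB σ)
    neg-fixed : ∀ x σ → All (λ τ → f τ ≡ monomial (b (endsWith j τ) (𝟙 ⌊ x ℤ.<? + 0 ⌋ + neg σ)) (desB τ) k) (insertAll x σ)
    neg-fixed x σ = All.map (λ {τ} → cong (λ m → monomial (b (endsWith j τ) m) (desB τ) k)) (insertAll-neg x σ)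
    max-slots : ∀ {σ} → Bounded n σ → ∑ (insertAll (+ suc n) σ) f ≡ (Φ n (M⁺ σ) ⊕ E⁺ σ) k
    max-slots {σ} bd = trans (∑-cong-All (neg-fixed (+ suc n) σ)) (insertMax bd j (λ e → b e (neg σ)) k)
    min-slots : ∀ {σ} → Bounded n σ → ∑ (insertAll -[1+ n ] σ) f ≡ (Φ n (M⁻ σ) ⊕ t· (E⁻ σ)) k
    min-slots {σ} bd = trans (∑-cong-All (neg-fixed -[1+ n ] σ)) (insertMin bd j (λ e → b e (suc (neg σ))) k)

⌊+suc≟+⌋ : ∀ {n j} → j ≤ n → ⌊ + suc n ℤ.≟ + j ⌋ ≡ false
⌊+suc≟+⌋ j≤n = ⌊⌋-false _ (λ eq → ℕ.<-irrefl (sym (ℤ.+-injective eq)) (s≤s j≤n))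

A-suc : ∀ {n j} → j ≤ n → A (suc n) j ≗ Φ n (A n j)
A-suc {n} {j} j≤n k = begin
  A (suc n) j k
    ≡⟨ desPoly-perms-suc n (+ j) (λ e → e) k ⟩
  Φ n (A n j) k + desPoly (λ _ → ⌊ + suc n ℤ.≟ + j ⌋) (perms n) k
    ≡⟨ cong (_+_ (Φ n (A n j) k)) (desPoly-false (perms n) (⌊+suc≟+⌋ j≤n) k) ⟩
  Φ n (A n j) k + 0
    ≡⟨ ℕ.+-identityʳ _ ⟩
  Φ n (A n j) k ∎
  where open ≡-Reasoning

A-suc-last : ∀ n → A (suc n) (suc n) ≗ Atotal n
A-suc-last n k = begin
  A (suc n) (suc n) k
    ≡⟨ desPoly-perms-suc n (+ suc n) (λ e → e) k ⟩
  Φ n (A n (suc n)) k + desPoly (λ _ → ⌊ + suc n ℤ.≟ + suc n ⌋) (perms n) k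
    ≡⟨ cong₂ _+_ (Φ-zero (desPoly-endsWith-max (perms-bounded n)) k)
                 (cong (λ b → desPoly (λ _ → b) (perms n) k) (⌊⌋-true (+ suc n ℤ.≟ + suc n) refl)) ⟩
  Atotal n k ∎
  where open ≡-Reasoning

Atotal-suc : ∀ n → Atotal (suc n) ≗ Φ n (Atotal n) ⊕ Atotal n
Atotal-suc n = desPoly-perms-suc n (+ 0) (λ _ → true)

B-suc : ∀ {n j} → j ≤ n → B (suc n) j ≗ 2 ⊛ Φ n (B n j)
B-suc {n} {j} j≤n k = begin
  B (suc n) j k
    ≡⟨ desPoly-signedPerms-suc n (+ j) (λ e _ → e) k ⟩
  Φ n (B n j) k + desPoly (λ _ → ⌊ + suc n ℤ.≟ + j ⌋) (signedPerms n) k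
    + (Φ n (B n j) k + t· (desPoly (λ _ → false) (signedPerms n)) k)
    ≡⟨ cong₂ (λ a b → Φ n (B n j) k + a + (Φ n (B n j) k + b))
             (desPoly-false (signedPerms n) (⌊+suc≟+⌋ j≤n) k) (t·-zero (desPoly-false (signedPerms n) refl) k) ⟩
  Φ n (B n j) k + 0 + (Φ n (B n j) k + 0)
    ≡⟨ double (Φ n (B n j) k) ⟩
  2 * Φ n (B n j) k ∎
  where
    open ≡-Reasoning
    double : ∀ a → a + 0 + (a + 0) ≡ 2 * a
    double = solve-∀

B-suc-last : ∀ n → B (suc n) (suc n) ≗ Btotal n
B-suc-last n k = begin
  B (suc n) (suc n) k
    ≡⟨ desPoly-signedPerms-suc n (+ suc n) (λ e _ → e) k ⟩
  Φ n (B n (suc n)) k + desPoly (λ _ → ⌊ + suc n ℤ.≟ + suc n ⌋) (signedPerms n) k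
    + (Φ n (B n (suc n)) k + t· (desPoly (λ _ → false) (signedPerms n)) k)
    ≡⟨ cong₂ _+_ (cong₂ _+_ Φ-B≡0 (cong (λ b → desPoly (λ _ → b) (signedPerms n) k) (⌊⌋-true (+ suc n ℤ.≟ + suc n) refl)))
                 (cong₂ _+_ Φ-B≡0 (t·-zero (desPoly-false (signedPerms n) refl) k)) ⟩
  Btotal n k + 0
    ≡⟨ ℕ.+-identityʳ _ ⟩
  Btotal n k ∎
  where
    open ≡-Reasoning
    Φ-B≡0 : Φ n (B n (suc n)) k ≡ 0
    Φ-B≡0 = Φ-zero (desPoly-endsWith-max (signedPerms-bounded n)) k

Bneg-suc-zero : ∀ n → Bneg (suc n) 0 ≗ Φ n (Bneg n 0) ⊕ Bneg n 0
Bneg-suc-zero n k = begin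
  Bneg (suc n) 0 k
    ≡⟨ desPoly-signedPerms-suc n (+ 0) (λ _ m → ⌊ m ≟ 0 ⌋) k ⟩
  Φ n (Bneg n 0) k + Bneg n 0 k + (Φ n none k + t· none k)
    ≡⟨ cong (_+_ (Φ n (Bneg n 0) k + Bneg n 0 k)) (cong₂ _+_ (Φ-zero none≗0 k) (t·-zero none≗0 k)) ⟩
  Φ n (Bneg n 0) k + Bneg n 0 k + 0
    ≡⟨ ℕ.+-identityʳ _ ⟩
  Φ n (Bneg n 0) k + Bneg n 0 k ∎
  where
    open ≡-Reasoning
    none : ℕ → ℕ
    none = desPoly (λ _ → false) (signedPerms n)
    none≗0 : none ≗ λ _ → 0
    none≗0 = desPoly-false (signedPerms n) refl

Bneg-suc-suc : ∀ n s → Bneg (suc n) (suc s) ≗ Φ n (Bneg n (suc s)) ⊕ Bneg n (suc s) ⊕ (Φ n (Bneg n s) ⊕ t· (Bneg n s))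
Bneg-suc-suc n s k =
  trans (desPoly-signedPerms-suc n (+ 0) (λ _ m → ⌊ m ≟ suc s ⌋) k)
        (cong (_+_ (Φ n (Bneg n (suc s)) k + Bneg n (suc s) k)) (cong₂ _+_ (Φ-cong {n} one-more k) (t·-cong one-more k)))
  where
    one-more : desPoly (λ σ → ⌊ suc (neg σ) ≟ suc s ⌋) (signedPerms n) ≗ Bneg n s
    one-more = desPoly-cong (λ σ → ⌊suc≟suc⌋ (neg σ) s) (signedPerms n)

desPoly-partition : ∀ (stat : List ℤ → ℕ) N ws → All (λ w → stat w < N) ws →
  desPoly (λ _ → true) ws ≗ λ k → ∑[ s ∈ upTo N ] desPoly (λ w → ⌊ stat w ≟ s ⌋) ws k
desPoly-partition stat N ws bounds k =
  trans (∑-cong-All (All.map (λ {w} lt → sym (∑-upTo-indicator lt ⌊ desB w ≟ k ⌋)) bounds))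
        (∑-comm (λ w s → monomial ⌊ stat w ≟ s ⌋ (desB w) k) ws (upTo N))

Btotal-by-neg : ∀ n → Btotal n ≗ λ k → ∑[ s ∈ upTo (suc n) ] Bneg n s k
Btotal-by-neg n = desPoly-partition neg (suc n) (signedPerms n)
  (All.map (λ {σ} (l , _) → s≤s (ℕ.≤-trans (neg-≤ σ) (ℕ.≤-reflexive l))) (signedPerms-bounded n))

desB-positive : ∀ π → All (+ 0 ℤ.<_) π → desB π ≡ des π
desB-positive [] _ = refl
desB-positive (y ∷ ys) (0<y ∷ _) = cong (λ b → 𝟙 b + des (y ∷ ys)) (⌊⌋-false (y ℤ.<? + 0) (ℤ.<-asym 0<y))

monomial-vanishes : ∀ b {d k} → d < k → monomial b d k ≡ 0
monomial-vanishes b {d} {k} d<k = cong 𝟙 (trans (cong (b ∧_) (⌊⌋-false (d ≟ k) (ℕ.<⇒≢ d<k))) (∧-zeroʳ b))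

A-deg : ∀ n r → Deg n (A (suc n) r)
A-deg n r k n<k = trans (∑-cong-All (All.zipWith vanish (perms-length (suc n) , perms-letters (suc n)))) (∑-zero (perms (suc n)))
  where
    vanish : ∀ {π} → length π ≡ suc n × All (PosLetter (suc n)) π → monomial (endsWith (+ r) π) (desB π) k ≡ 0
    vanish {y ∷ ys} (refl , a) rewrite desB-positive (y ∷ ys) (All.map proj₁ a) =
      monomial-vanishes (endsWith (+ r) (y ∷ ys)) (ℕ.≤-<-trans (des-≤ y ys) n<k)

A-suc-suc : ∀ m {r} → 1 ≤ r → r ≤ suc m → A (suc (suc m)) (suc r) ≗ Φ m (A (suc m) r) ⊕ A (suc m) r
A-suc-suc m {r} 1≤r r≤1+m k with ℕ.m≤n⇒m<n∨m≡n r≤1+m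
... | inj₂ refl = begin
  A (suc (suc m)) (suc (suc m)) k             ≡⟨ A-suc-last (suc m) k ⟩
  Atotal (suc m) k                            ≡⟨ Atotal-suc m k ⟩
  Φ m (Atotal m) k + Atotal m k               ≡⟨ sym (cong₂ _+_ (Φ-cong (A-suc-last m) k) (A-suc-last m k)) ⟩
  Φ m (A (suc m) (suc m)) k + A (suc m) (suc m) k ∎
  where open ≡-Reasoning
A-suc-suc (suc m) {r} 1≤r _ k | inj₁ (s≤s r≤1+m) = begin
  A (3 + m) (suc r) k                           ≡⟨ A-suc (s≤s r≤1+m) k ⟩
  Φ (2 + m) (A (2 + m) (suc r)) k               ≡⟨ Φ-cong (A-suc-suc m 1≤r r≤1+m) k ⟩
  Φ (2 + m) (Φ m H ⊕ H) k                       ≡⟨ sym (Φ-square (A-deg m r) k) ⟩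
  Φ (suc m) (Φ (suc m) H) k + Φ (suc m) H k     ≡⟨ sym (cong₂ _+_ (Φ-cong (A-suc r≤1+m) k) (A-suc r≤1+m k)) ⟩
  Φ (suc m) (A (2 + m) r) k + A (2 + m) r k     ∎
  where
    open ≡-Reasoning
    H = A (suc m) r
A-suc-suc zero {suc r} _ _ k | inj₁ (s≤s ())

Bneg-binomial : ∀ m s → Bneg m s ≗ (m C s) ⊛ A (suc m) (suc m ∸ s)
Bneg-binomial zero zero k = sym (ℕ.*-identityˡ _)
Bneg-binomial zero (suc s) k = refl
Bneg-binomial (suc m) zero k = begin
  Bneg (suc m) 0 k                              ≡⟨ Bneg-suc-zero m k ⟩
  Φ m (Bneg m 0) k + Bneg m 0 k                 ≡⟨ cong₂ _+_ (Φ-cong all-positive k) (all-positive k) ⟩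
  Φ m (A (suc m) (suc m)) k + A (suc m) (suc m) k ≡⟨ sym (A-suc-suc m (s≤s z≤n) ℕ.≤-refl k) ⟩
  A (2 + m) (2 + m) k                           ≡⟨ sym (ℕ.*-identityˡ _) ⟩
  1 * A (2 + m) (2 + m) k                       ∎
  where
    open ≡-Reasoning
    all-positive : Bneg m 0 ≗ A (suc m) (suc m)
    all-positive k = trans (Bneg-binomial m 0 k) (ℕ.*-identityˡ _)
Bneg-binomial (suc m) (suc s) k = begin
  Bneg (suc m) (suc s) k
    ≡⟨ Bneg-suc-suc m s k ⟩
  Φ m (Bneg m (suc s)) k + Bneg m (suc s) k + (Φ m (Bneg m s) k + t· (Bneg m s) k)
    ≡⟨ cong₂ _+_ (cong₂ _+_ (trans (Φ-cong (Bneg-binomial m (suc s)) k) (Φ-⊛ C₁ E₁ k)) (Bneg-binomial m (suc s) k))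
                 (cong₂ _+_ (trans (Φ-cong (Bneg-binomial m s) k) (Φ-⊛ C₀ E₀ k))
                            (trans (t·-cong (Bneg-binomial m s) k) (t·-⊛ C₀ E₀ k))) ⟩
  C₁ * Φ m E₁ k + C₁ * E₁ k + (C₀ * Φ m E₀ k + C₀ * t· E₀ k)
    ≡⟨ sym (cong₂ _+_ (ℕ.*-distribˡ-+ C₁ _ _) (ℕ.*-distribˡ-+ C₀ _ _)) ⟩
  C₁ * (Φ m E₁ k + E₁ k) + C₀ * (Φ m E₀ k + t· E₀ k)
    ≡⟨ cong₂ _+_ C₁-term (cong (C₀ *_) C₀-term) ⟩
  C₁ * A′ k + C₀ * A′ k
    ≡⟨ trans (ℕ.+-comm (C₁ * A′ k) _) (sym (ℕ.*-distribʳ-+ (A′ k) C₀ C₁)) ⟩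
  (C₀ + C₁) * A′ k
    ≡⟨ cong (_* A′ k) (nCk+nC[k+1]≡[n+1]C[k+1] m s) ⟩
  (suc m C suc s) * A′ k ∎
  where
    open ≡-Reasoning
    C₀ = m C s
    C₁ = m C suc s
    E₀ = A (suc m) (suc m ∸ s)
    E₁ = A (suc m) (m ∸ s)
    A′ = A (suc (suc m)) (suc m ∸ s)
    C₀-term : Φ m E₀ k + t· E₀ k ≡ A′ k
    C₀-term = trans (sym (Φ-suc (A-deg m _) k)) (sym (A-suc (ℕ.m∸n≤m (suc m) s) k))
    C₁-term : C₁ * (Φ m E₁ k + E₁ k) ≡ C₁ * A′ k
    C₁-term with s ℕ.<? m
    ... | yes s<m = cong (C₁ *_) (sym (trans (cong (λ r → A (suc (suc m)) r k) (ℕ.+-∸-assoc 1 (ℕ.<⇒≤ s<m)))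
                                              (A-suc-suc m (ℕ.m<n⇒0<n∸m s<m) (ℕ.m≤n⇒m≤1+n (ℕ.m∸n≤m m s)) k)))
    ... | no s≮m rewrite k>n⇒nCk≡0 {m} {suc s} (s≤s (ℕ.≮⇒≥ s≮m)) = refl

binomial-A : ℕ → ℕ → ℕ → ℕ
binomial-A i n k = ∑[ j ∈ upTo i ] (((i ∸ 1) C j) * A n (i ∸ j) k)

binomial-A-suc : ∀ {i n} → i ≤ n → binomial-A i (suc n) ≗ Φ n (binomial-A i n)
binomial-A-suc {i} {n} i≤n k = begin
  ∑[ j ∈ upTo i ] (((i ∸ 1) C j) * A (suc n) (i ∸ j) k)
    ≡⟨ ∑-cong (λ j → cong (((i ∸ 1) C j) *_) (A-suc (ℕ.≤-trans (ℕ.m∸n≤m i j) i≤n) k)) (upTo i) ⟩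
  ∑[ j ∈ upTo i ] (((i ∸ 1) C j) * Φ n (A n (i ∸ j)) k)
    ≡⟨ ∑-cong (λ j → sym (Φ-⊛ ((i ∸ 1) C j) (A n (i ∸ j)) k)) (upTo i) ⟩
  ∑[ j ∈ upTo i ] Φ n (((i ∸ 1) C j) ⊛ A n (i ∸ j)) k
    ≡⟨ sym (Φ-∑ (λ j → ((i ∸ 1) C j) ⊛ A n (i ∸ j)) (upTo i) k) ⟩
  Φ n (binomial-A i n) k ∎
  where open ≡-Reasoning

B-diagonal : ∀ i → B (suc i) (suc i) ≗ binomial-A (suc i) (suc i)
B-diagonal i k = begin
  B (suc i) (suc i) k                                 ≡⟨ B-suc-last i k ⟩
  Btotal i k                                          ≡⟨ Btotal-by-neg i k ⟩
  ∑[ s ∈ upTo (suc i) ] Bneg i s k                    ≡⟨ ∑-cong (λ s → Bneg-binomial i s k) (upTo (suc i)) ⟩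
  ∑[ s ∈ upTo (suc i) ] ((i C s) * A (suc i) (suc i ∸ s) k) ∎
  where open ≡-Reasoning

B-formula : ∀ {i n} → 1 ≤ i → i ≤′ n → B n i ≗ 2 ^ (n ∸ i) ⊛ binomial-A i n
B-formula {suc i} _ ≤′-refl k = begin
  B (suc i) (suc i) k                             ≡⟨ B-diagonal i k ⟩
  binomial-A (suc i) (suc i) k                    ≡⟨ sym (ℕ.*-identityˡ _) ⟩
  2 ^ 0 * binomial-A (suc i) (suc i) k            ≡⟨ cong (λ e → 2 ^ e * binomial-A (suc i) (suc i) k) (sym (ℕ.n∸n≡0 i)) ⟩
  2 ^ (suc i ∸ suc i) * binomial-A (suc i) (suc i) k ∎
  where open ≡-Reasoning
B-formula {i} {suc n} 1≤i (≤′-step i≤′n) k = begin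
  B (suc n) i k                                   ≡⟨ B-suc i≤n k ⟩
  2 * Φ n (B n i) k                               ≡⟨ cong (2 *_) (trans (Φ-cong (B-formula 1≤i i≤′n) k) (Φ-⊛ (2 ^ (n ∸ i)) _ k)) ⟩
  2 * (2 ^ (n ∸ i) * Φ n (binomial-A i n) k)      ≡⟨ cong (λ x → 2 * (2 ^ (n ∸ i) * x)) (sym (binomial-A-suc i≤n k)) ⟩
  2 * (2 ^ (n ∸ i) * binomial-A i (suc n) k)      ≡⟨ sym (ℕ.*-assoc 2 (2 ^ (n ∸ i)) (binomial-A i (suc n) k)) ⟩
  2 ^ suc (n ∸ i) * binomial-A i (suc n) k        ≡⟨ cong (λ e → 2 ^ e * binomial-A i (suc n) k) (sym (ℕ.+-∸-assoc 1 i≤n)) ⟩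
  2 ^ (suc n ∸ i) * binomial-A i (suc n) k        ∎
  where
    open ≡-Reasoning
    i≤n = ℕ.≤′⇒≤ i≤′n

Acoeff≡A : ∀ n r k → Acoeff n (+ r) k ≡ A n r k
Acoeff≡A n r k = trans (count≡∑ _ (perms n)) (∑-cong-All (All.map positive (perms-letters n)))
  where
    positive : ∀ {π} → All (PosLetter n) π → 𝟙 (endsWith (+ r) π ∧ ⌊ des π ≟ k ⌋) ≡ monomial (endsWith (+ r) π) (desB π) k
    positive {π} a = cong (λ d → 𝟙 (endsWith (+ r) π ∧ ⌊ d ≟ k ⌋)) (sym (desB-positive π (All.map proj₁ a)))

theorem1p2 : (n i : ℕ) → 1 ≤ n → 1 ≤ i → i ≤ n → (k : ℕ) →
    Bcoeff n (+ i) k ≡ 2 ^ (n ∸ i) * sum (map (λ j → ((i ∸ 1) C j) * Acoeff n (+ (i ∸ j)) k) (upTo i))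
theorem1p2 n i _ 1≤i i≤n k = begin
  Bcoeff n (+ i) k
    ≡⟨ count≡∑ _ (signedPerms n) ⟩
  B n i k
    ≡⟨ B-formula 1≤i (ℕ.≤⇒≤′ i≤n) k ⟩
  2 ^ (n ∸ i) * binomial-A i n k
    ≡⟨ cong (2 ^ (n ∸ i) *_) (∑-cong (λ j → cong (((i ∸ 1) C j) *_) (sym (Acoeff≡A n (i ∸ j) k))) (upTo i)) ⟩
  2 ^ (n ∸ i) * ∑[ j ∈ upTo i ] (((i ∸ 1) C j) * Acoeff n (+ (i ∸ j)) k) ∎
  where open ≡-Reasoning
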